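{- Let $(\mathcal V,\mathcal T_\#)$ be a fann. Then there is a surjective natural morphism from Cantor space onto $(\mathcal V,\mathcal T_\#)$ (every point of $\mathcal V$ is $\equiv$ to the image of some point of Cantor space).
   Context: Setting: Bishop-style constructive mathematics. Pre-natural space $(V,\#,\preccurlyeq)$: $V$ countable, $\#,\preccurlyeq$ decidable, $\#$ symmetric irreflexive, $\preccurlyeq$ partial order, $a\preccurlyeq b\wedge c\#b\Rightarrow c\#a$; $a\prec b$ means $a\preccurlyeq b,a\ne b$. Points: sequences $(p_n)$ in $V$ with $p_{n+1}\preccurlyeq p_n$, each $n$ some $m$ with $p_m\prec p_n$, for every $a\#b$ some $m$ with $p_m\#a$ or $p_m\#b$; $\mathcal V$ = points; $p\#q$ iff $\exists n\,p_n\#q_n$; $p\equiv q$ iff not $p\#q$; $\hat a=\{p:\exists m\,p_m\prec a\}$; apartness topology as usual ($U$ open iff for $x\in U$, $y$ a point, one can determine $y\#x$ or $\widehat{y_m}\subseteq U$ for some $m$). Natural space: maximal dot $\top$ exists and each $\hat a$ is inhabited. A natural morphism is a refinement morphism ($f:V\to W$ with $f(a)\#f(b)\Rightarrow a\#b$, $a\preccurlyeq b\Rightarrow f(a)\preccurlyeq f(b)$, points mapped to points) or a trail morphism (refinement morphism defined on finite strictly decreasing initial-segment trails of points). $a$ is an immediate successor of $c$ if $a\prec c$ and no $b$ satisfies $a\prec b\prec c$; $\mathrm{suc}(c)$ denotes the set of immediate successors. $(V,\preccurlyeq)$ is a trea if each $a$ has finitely many $b$ with $a\preccurlyeq b$ and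 there is $\mathrm{grd}(a)\in\mathbb N$ such that every chain of immediate successors from $\top$ to $a$ has length $\mathrm{grd}(a)$. A spraid is a natural space whose $(V,\preccurlyeq)$ is a trea and in which every infinite strictly decreasing sequence of dots is a point. A fann is a spraid with $\mathrm{suc}(c)$ finite for all $c$. Cantor space is the natural space derived from $(\{0,1\}^*,\#_\omega,\preccurlyeq_\omega)$: finite binary sequences, $b\preccurlyeq_\omega a$ iff $b$ extends $a$, $a\#_\omega b$ iff neither extends the other. -}

module Defs where

open import Data.Nat using (ℕ; zero; suc)
open import Data.List using (List; []; _∷_; _++_)
open import Data.List.Membership.Propositional using (_∈_)
open import Data.List.Properties using (≡-dec)
open import Data.Bool using (Bool)
import Data.Bool as B
open import Data.Product using (Σ; ∃; _×_; _,_; proj₁; proj₂)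
open import Data.Sum using (_⊎_; inj₁; inj₂)
open import Data.Empty using (⊥)
open import Relation.Nullary using (¬_; Dec; yes; no)
open import Relation.Binary.Definitions using (DecidableEquality)
open import Relation.Binary.PropositionalEquality using (_≡_)
open import Function using (_∘_)

record RawSpace : Set₁ where
  field
    Dot : Set
    _#_ : Dot → Dot → Set
    _≼_ : Dot → Dot → Set

module RawNotions (S : RawSpace) where
  open RawSpace S

  _≺_ : Dot → Dot → Set
  a ≺ b = (a ≼ b) × ¬ (a ≡ b)

  record IsPoint (p : ℕ → Dot) : Set where
    field
      decr       : ∀ n → p (suc n) ≼ p n
      progress   : ∀ n → ∃ λ m → p m ≺ p n
      separating : ∀ a b → a # b → ∃ λ m → (p m # a) ⊎ (p m # b)

  _#ₚ_ : (ℕ → Dot) → (ℕ → Dot) → Set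
  p #ₚ q = ∃ λ n → p n # q n

  _≡ₚ_ : (ℕ → Dot) → (ℕ → Dot) → Set
  p ≡ₚ q = ¬ (p #ₚ q)

  ImmSuc : Dot → Dot → Set
  ImmSuc a c = (a ≺ c) × ¬ (∃ λ b → (a ≺ b) × (b ≺ c))

  data Chain (c : Dot) : Dot → ℕ → Set where
    here : Chain c c 0
    step : ∀ {a b k} → Chain c b k → ImmSuc a b → Chain c a (suc k)

  -- trails, written with the most recent (smallest) dot first:
  -- a list  aₙ ∷ … ∷ a₀  with  aₙ ≺ … ≺ a₀
  data IsTrail : List Dot → Set where
    single : ∀ a → IsTrail (a ∷ [])
    cons   : ∀ a b t → a ≺ b → IsTrail (b ∷ t) → IsTrail (a ∷ b ∷ t)

  -- t ≼ s iff s is an initial segment of t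
  _≼ₜ_ : List Dot → List Dot → Set
  t ≼ₜ s = ∃ λ u → t ≡ u ++ s

  _#ₜ_ : List Dot → List Dot → Set
  (a ∷ _) #ₜ (b ∷ _) = a # b
  _       #ₜ _       = ⊥

  trails : DecidableEquality Dot → (ℕ → Dot) → ℕ → List Dot
  trails eq p zero = p zero ∷ []
  trails eq p (suc n) with eq (p (suc n)) (p n)
  ... | yes _ = trails eq p n
  ... | no  _ = p (suc n) ∷ trails eq p n

record PreNatural : Set₁ where
  field
    raw : RawSpace
  open RawSpace raw public
  open RawNotions raw public
  field
    enum      : ℕ → Dot
    enum-surj : ∀ a → ∃ λ n → enum n ≡ a
    #-dec : ∀ a b → Dec (a # b)
    ≼-dec : ∀ a b → Dec (a ≼ b)
    #-sym    : ∀ {a b} → a # b → b # a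
    #-irrefl : ∀ a → ¬ (a # a)
    ≼-refl    : ∀ a → a ≼ a
    ≼-trans   : ∀ {a b c} → a ≼ b → b ≼ c → a ≼ c
    ≼-antisym : ∀ {a b} → a ≼ b → b ≼ a → a ≡ b
    #-≼ : ∀ {a b c} → a ≼ b → c # b → c # a

module _ (V : PreNatural) where
  open PreNatural V

  record IsNatural : Set where
    field
      ⊤      : Dot
      ⊤-max  : ∀ a → a ≼ ⊤
      hat-inhabited : ∀ a → Σ (ℕ → Dot) λ p → IsPoint p × (∃ λ m → p m ≺ a)

  record IsTrea (⊤ : Dot) : Set where
    field
      above-finite : ∀ a → Σ (List Dot) λ L → ∀ b → ((a ≼ b) → b ∈ L) × (b ∈ L → a ≼ b)
      grd          : Dot → ℕ
      grd-spec     : ∀ a k → Chain ⊤ a k → k ≡ grd a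

  record IsSpraid : Set where
    field
      natural : IsNatural
    open IsNatural natural public
    field
      trea : IsTrea ⊤
      decreasing-is-point : ∀ (p : ℕ → Dot) → (∀ n → p (suc n) ≺ p n) → IsPoint p

  record IsFann : Set where
    field
      spraid : IsSpraid
      suc-finite : ∀ c → Σ (List Dot) λ L → ∀ a → (ImmSuc a c → a ∈ L) × (a ∈ L → ImmSuc a c)

module _ (S T : RawSpace) where
  private
    module S = RawSpace S
    module T = RawSpace T
    module NS = RawNotions S
    module NT = RawNotions T

  record RefinementMorphism : Set where
    field
      fun        : S.Dot → T.Dot
      reflect-#  : ∀ a b → fun a T.# fun b → a S.# b
      preserve-≼ : ∀ a b → a S.≼ b → fun a T.≼ fun b
      points     : ∀ p → NS.IsPoint p → NT.IsPoint (fun ∘ p)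

  record TrailMorphism (eq : DecidableEquality S.Dot) : Set where
    field
      fun        : List S.Dot → T.Dot
      reflect-#  : ∀ t s → NS.IsTrail t → NS.IsTrail s → fun t T.# fun s → t NS.#ₜ s
      preserve-≼ : ∀ t s → NS.IsTrail t → NS.IsTrail s → t NS.≼ₜ s → fun t T.≼ fun s
      points     : ∀ p → NS.IsPoint p → NT.IsPoint (fun ∘ NS.trails eq p)

  NaturalMorphism : DecidableEquality S.Dot → Set
  NaturalMorphism eq = RefinementMorphism ⊎ TrailMorphism eq

  image : (eq : DecidableEquality S.Dot) → NaturalMorphism eq → (ℕ → S.Dot) → ℕ → T.Dot
  image eq (inj₁ f) p = RefinementMorphism.fun f ∘ p
  image eq (inj₂ f) p = TrailMorphism.fun f ∘ NS.trails eq p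

  Surjective : (eq : DecidableEquality S.Dot) → NaturalMorphism eq → Set
  Surjective eq f = ∀ x → NT.IsPoint x →
    Σ (ℕ → S.Dot) λ p → NS.IsPoint p × NT._≡ₚ_ (image eq f p) x

_≼ω_ : List Bool → List Bool → Set
b ≼ω a = ∃ λ s → b ≡ a ++ s

_#ω_ : List Bool → List Bool → Set
a #ω b = ¬ (a ≼ω b) × ¬ (b ≼ω a)

Cantor : RawSpace
Cantor = record { Dot = List Bool ; _#_ = _#ω_ ; _≼_ = _≼ω_ }

Cantor-≟ : DecidableEquality (List Bool)
Cantor-≟ = ≡-dec B._≟_

-- A binary word is read as a walk down the fann: at each dot its finitely many immediate
-- successors (at least one, as every hat is inhabited) are offered one at a time, and each bit
-- accepts or passes on the current offer, passing on the last offer accepting it.  Decoding is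
-- antitone in the prefix order, so apartness of decoded dots forces incomparability of the
-- words; along a Cantor point runs of passes are bounded, so the decoded dots keep strictly
-- descending, and a strictly progressing decreasing sequence in a spraid is a point.
-- Conversely a point x of the fann is tracked by a path of immediate successors, each lying
-- above a later x i (trea finiteness gives the immediate successor above any x m ≺ d); the
-- words encoding this path form a Cantor point whose image shares lower bounds with x, hence
-- cannot be apart from it.

module Submission where

open import Defs
open import Data.Nat using (ℕ; zero; suc; _+_; _≤_; _<_; _⊔_; z≤n; s≤s; _≤′_; ≤′-refl; ≤′-step)
open import Data.Nat.Properties using (≤-<-trans; <-irrefl; m≤m+n; m≤n+m; m≤m⊔n; m≤n⊔m; ≤⇒≤′)
open import Data.List using (List; []; _∷_; _++_; length; foldl)
open import Data.List.Properties using (++-assoc; ++-identityʳ; ∷-injectiveˡ; ∷-injectiveʳ; foldl-++; length-++-≤ˡ)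
open import Data.List.Membership.Propositional using (_∈_)
open import Data.List.Relation.Unary.Any using (here; there)
open import Data.List.Relation.Unary.All as All using (All; _∷_)
open import Data.Bool using (Bool; true; false) renaming (_≟_ to _≟𝔹_)
open import Data.Product using (Σ; ∃; _×_; _,_; proj₁; proj₂)
open import Data.Sum using (_⊎_; inj₁; inj₂)
open import Data.Empty using (⊥-elim)
open import Relation.Nullary using (¬_; Dec; yes; no)
open import Relation.Binary.Definitions using (DecidableEquality)
open import Relation.Binary.PropositionalEquality
  using (_≡_; _≢_; refl; sym; trans; cong; subst; module ≡-Reasoning)
open import Function using (_∘_)

module _ {A : Set} where

  extends? : DecidableEquality A → (b a : List A) → Dec (∃ λ u → b ≡ a ++ u)
  extends? _≟_ b       []      = yes (b , refl)
  extends? _≟_ []      (x ∷ a) = no λ ()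
  extends? _≟_ (y ∷ b) (x ∷ a) with y ≟ x | extends? _≟_ b a
  ... | yes refl | yes (u , e) = yes (u , cong (y ∷_) e)
  ... | yes refl | no ¬e       = no λ (u , e) → ¬e (u , ∷-injectiveʳ e)
  ... | no y≢x   | _           = no λ (u , e) → y≢x (∷-injectiveˡ e)

  ++-comparable : ∀ (a b u v : List A) → a ++ u ≡ b ++ v →
                  (∃ λ w → a ≡ b ++ w) ⊎ (∃ λ w → b ≡ a ++ w)
  ++-comparable []      b       _ _ _ = inj₂ (b , refl)
  ++-comparable (x ∷ a) []      _ _ _ = inj₁ (x ∷ a , refl)
  ++-comparable (x ∷ a) (y ∷ b) u v e with ∷-injectiveˡ e
  ... | refl with ++-comparable a b u v (∷-injectiveʳ e)
  ...   | inj₁ (w , e′) = inj₁ (w , cong (x ∷_) e′)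
  ...   | inj₂ (w , e′) = inj₂ (w , cong (x ∷_) e′)

  shorter-¬extends : ∀ (b a : List A) → length b < length a → ¬ (∃ λ u → b ≡ a ++ u)
  shorter-¬extends b a b<a (u , refl) = <-irrefl refl (≤-<-trans (length-++-≤ˡ a) b<a)

  length-<-++ : ∀ (u : List A) {v : List A} → v ≢ [] → length u < length (u ++ v)
  length-<-++ []      {[]}    v≢[] = ⊥-elim (v≢[] refl)
  length-<-++ []      {_ ∷ _} v≢[] = s≤s z≤n
  length-<-++ (x ∷ u)         v≢[] = s≤s (length-<-++ u v≢[])

  ++-≢ : ∀ (u : List A) {v : List A} → v ≢ [] → u ++ v ≢ u
  ++-≢ u v≢[] e = <-irrefl (sym (cong length e)) (length-<-++ u v≢[])

  proper-suffix-nonempty : ∀ {a b u : List A} → b ≡ a ++ u → b ≢ a → u ≢ []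
  proper-suffix-nonempty e b≢a refl = b≢a (trans e (++-identityʳ _))

module CN = RawNotions Cantor

longer-#ω : ∀ (s a b : List Bool) → a #ω b → length a < length s → length b < length s →
            (s #ω a) ⊎ (s #ω b)
longer-#ω s a b a#b a<s b<s with extends? _≟𝔹_ s a | extends? _≟𝔹_ s b
... | no ¬s≼a | _ = inj₁ (¬s≼a , shorter-¬extends a s a<s)
... | yes _ | no ¬s≼b = inj₂ (¬s≼b , shorter-¬extends b s b<s)
... | yes (u , eu) | yes (v , ev) with ++-comparable a b u v (trans (sym eu) ev)
...   | inj₁ a≼b = ⊥-elim (proj₁ a#b a≼b)
...   | inj₂ b≼a = ⊥-elim (proj₂ a#b b≼a)

IsPoint-deepens : ∀ {p} → CN.IsPoint p → ∀ K n → ∃ λ m → ∃ λ u → p m ≡ p n ++ u × K ≤ length u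
IsPoint-deepens {p} _  zero n = n , [] , sym (++-identityʳ (p n)) , z≤n
IsPoint-deepens {p} pp (suc K) n with IsPoint-deepens pp K n
... | m , u , pm≡pn++u , K≤u with CN.IsPoint.progress pp m
...   | m′ , (v , pm′≡pm++v) , pm′≢pm =
  m′ , u ++ v ,
  trans pm′≡pm++v (trans (cong (_++ v) pm≡pn++u) (++-assoc (p n) u v)) ,
  ≤-<-trans K≤u (length-<-++ u (proper-suffix-nonempty pm′≡pm++v pm′≢pm))

strictly-extending-isPoint : ∀ {s} → (∀ k → s (suc k) CN.≺ s k) → CN.IsPoint s
strictly-extending-isPoint {s} s-ext = record
  { decr       = proj₁ ∘ s-ext
  ; progress   = λ k → suc k , s-ext k
  ; separating = λ a b a#b →
      let m = suc (length a + length b) in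
      m , longer-#ω (s m) a b a#b
            (≤-<-trans (m≤m+n (length a) (length b)) (length-s m))
            (≤-<-trans (m≤n+m (length b) (length a)) (length-s m))
  }
  where
  length-s : ∀ k → k ≤ length (s k)
  length-s zero    = z≤n
  length-s (suc k) with s-ext k
  ... | (v , e) , ne = subst (λ w → suc k ≤ length w) (sym e)
                         (≤-<-trans (length-s k) (length-<-++ (s k) (proper-suffix-nonempty e ne)))

module _ (V : PreNatural) where
  open PreNatural V

  ≡-dec : DecidableEquality Dot
  ≡-dec a b with ≼-dec a b | ≼-dec b a
  ... | yes a≼b | yes b≼a = yes (≼-antisym a≼b b≼a)
  ... | no a⋠b  | _       = no λ { refl → a⋠b (≼-refl a) }
  ... | yes _   | no b⋠a  = no λ { refl → b⋠a (≼-refl a) }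

  ≺-dec : ∀ a b → Dec (a ≺ b)
  ≺-dec a b with ≼-dec a b | ≡-dec a b
  ... | yes a≼b | no a≢b = yes (a≼b , a≢b)
  ... | yes _   | yes a≡b = no λ a≺b → proj₂ a≺b a≡b
  ... | no a⋠b  | _       = no λ a≺b → a⋠b (proj₁ a≺b)

  ≼-≺-trans : ∀ {a b c} → a ≼ b → b ≺ c → a ≺ c
  ≼-≺-trans a≼b (b≼c , b≢c) = ≼-trans a≼b b≼c , λ { refl → b≢c (≼-antisym b≼c a≼b) }

  ≺-≼-trans : ∀ {a b c} → a ≺ b → b ≼ c → a ≺ c
  ≺-≼-trans (a≼b , a≢b) b≼c = ≼-trans a≼b b≼c , λ { refl → a≢b (≼-antisym a≼b b≼c) }

  #⇒¬common-lower-bound : ∀ {e a b} → e ≼ a → e ≼ b → ¬ (a # b)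
  #⇒¬common-lower-bound {e} e≼a e≼b a#b = #-irrefl e (#-≼ e≼a (#-sym (#-≼ e≼b a#b)))

  decreasing-antitone : ∀ {x : ℕ → Dot} → (∀ n → x (suc n) ≼ x n) → ∀ {i j} → i ≤ j → x j ≼ x i
  decreasing-antitone {x} decr {i} i≤j = go (≤⇒≤′ i≤j)
    where
    go : ∀ {j} → i ≤′ j → x j ≼ x i
    go ≤′-refl        = ≼-refl (x i)
    go (≤′-step i≤′j) = ≼-trans (decr _) (go i≤′j)

  data MaximalIn (P : Dot → Set) (A : List Dot) : Set where
    absent : (∀ y → y ∈ A → ¬ P y) → MaximalIn P A
    found  : ∀ m → m ∈ A → P m → (∀ y → y ∈ A → P y → ¬ (m ≺ y)) → MaximalIn P A

  maximalIn : ∀ (P : Dot → Set) → (∀ y → Dec (P y)) → ∀ A → MaximalIn P A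
  maximalIn P P? [] = absent λ _ ()
  maximalIn P P? (x ∷ A) with maximalIn P P? A | P? x
  ... | absent ¬P | no ¬Px = absent λ { y (here refl) → ¬Px ; y (there y∈A) → ¬P y y∈A }
  ... | absent ¬P | yes Px =
    found x (here refl) Px λ { y (here refl) _ x≺x → proj₂ x≺x refl ; y (there y∈A) Py _ → ¬P y y∈A Py }
  ... | found m m∈A Pm max | no ¬Px =
    found m (there m∈A) Pm λ { y (here refl) Px _ → ¬Px Px ; y (there y∈A) → max y y∈A }
  ... | found m m∈A Pm max | yes Px with ≺-dec m x
  ...   | yes m≺x = found x (here refl) Px λ
    { y (here refl) _ x≺x → proj₂ x≺x refl
    ; y (there y∈A) Py x≺y → max y y∈A Py (≺-≼-trans m≺x (proj₁ x≺y)) }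
  ...   | no m⊀x = found m (there m∈A) Pm λ { y (here refl) _ → m⊀x ; y (there y∈A) → max y y∈A }

  module _ {⊤ : Dot} (trea : IsTrea V ⊤) where
    open IsTrea trea

    -- The immediate successor is a ≺-maximal dot strictly below c among the finitely many above a.
    immSuc-above : ∀ {a c} → a ≺ c → Σ Dot λ b → ImmSuc b c × a ≼ b
    immSuc-above {a} {c} a≺c with above-finite a
    ... | A , A-spec with maximalIn (_≺ c) (λ y → ≺-dec y c) A
    ...   | absent ¬P = ⊥-elim (¬P a (proj₁ (A-spec a) (≼-refl a)) a≺c)
    ...   | found m m∈A m≺c max =
      m , (m≺c , λ (b , m≺b , b≺c) →
                   max b (proj₁ (A-spec b) (≼-trans a≼m (proj₁ m≺b))) b≺c m≺b) , a≼m
      where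
      a≼m : a ≼ m
      a≼m = proj₂ (A-spec m) m∈A

  module _ (S : IsSpraid V) where
    open IsSpraid S

    immSuc-exists : ∀ c → ∃ λ b → ImmSuc b c
    immSuc-exists c with hat-inhabited c
    ... | p , _ , m , pm≺c with immSuc-above trea pm≺c
    ...   | b , b⋖c , _ = b , b⋖c

    progressive-isPoint : ∀ {q : ℕ → Dot} → (∀ n → q (suc n) ≼ q n) →
                          (∀ n → ∃ λ m → q m ≺ q n) → IsPoint q
    progressive-isPoint {q} decr prog = record
      { decr       = decr
      ; progress   = prog
      ; separating = λ a b a#b → let k , h = IsPoint.separating subsequence-isPoint a b a#b in g k , h
      }
      where
      g : ℕ → ℕ
      g zero    = zero
      g (suc k) = proj₁ (prog (g k))

      subsequence-isPoint : IsPoint (q ∘ g)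
      subsequence-isPoint = decreasing-is-point (q ∘ g) (λ k → proj₂ (prog (g k)))

  module _ (F : IsFann V) where
    open IsFann F
    open IsSpraid spraid using (⊤; ⊤-max; trea)

    record SuccessorList (c : Dot) : Set where
      field
        first    : Dot
        rest     : List Dot
        sound    : All (λ a → ImmSuc a c) (first ∷ rest)
        complete : ∀ a → ImmSuc a c → a ∈ first ∷ rest

    toSuccessorList : ∀ {c e L} → e ∈ L →
                      (∀ a → (ImmSuc a c → a ∈ L) × (a ∈ L → ImmSuc a c)) → SuccessorList c
    toSuccessorList {L = x ∷ xs} _ L-spec = record
      { first    = x
      ; rest     = xs
      ; sound    = All.tabulate λ {a} → proj₂ (L-spec a)
      ; complete = λ a → proj₁ (L-spec a)
      }

    successors : ∀ c → SuccessorList c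
    successors c with suc-finite c | immSuc-exists spraid c
    ... | L , L-spec | e , e⋖c = toSuccessorList (proj₁ (L-spec e) e⋖c) L-spec

    record Position : Set where
      constructor position
      field
        dot       : Dot
        offered   : Dot
        remaining : List Dot
        below     : All (_≺ dot) (offered ∷ remaining)
    open Position using (dot; remaining)

    enter : Dot → Position
    enter c = position c first rest (All.map proj₁ sound)
      where open SuccessorList (successors c)

    move : Position → Bool → Position
    move (position _ r _ _)                   true  = enter r
    move (position _ r [] _)                  false = enter r
    move (position c _ (r′ ∷ rs) (_ ∷ below)) false = position c r′ rs below

    walk : Position → List Bool → Position
    walk = foldl move

    move-≼ : ∀ p b → dot (move p b) ≼ dot p
    move-≼ (position _ _ _ (r≺c ∷ _))  true  = proj₁ r≺c
    move-≼ (position _ _ [] (r≺c ∷ _)) false = proj₁ r≺c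
    move-≼ (position c _ (_ ∷ _) (_ ∷ _)) false = ≼-refl c

    walk-≼ : ∀ p s → dot (walk p s) ≼ dot p
    walk-≼ p []      = ≼-refl (dot p)
    walk-≼ p (b ∷ s) = ≼-trans (walk-≼ (move p b) s) (move-≼ p b)

    walk-≺ : ∀ p s → length (remaining p) < length s → dot (walk p s) ≺ dot p
    walk-≺ (position _ r _ (r≺c ∷ _))  (true ∷ s)  _ = ≼-≺-trans (walk-≼ (enter r) s) r≺c
    walk-≺ (position _ r [] (r≺c ∷ _)) (false ∷ s) _ = ≼-≺-trans (walk-≼ (enter r) s) r≺c
    walk-≺ (position c _ (r′ ∷ rs) (_ ∷ below)) (false ∷ s) (s≤s rs<s) =
      walk-≺ (position c r′ rs below) s rs<s

    walk-reaches : ∀ p {e} → e ∈ Position.offered p ∷ remaining p →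
                   Σ (List Bool) λ w → w ≢ [] × walk p w ≡ enter e
    walk-reaches (position _ _ _ _) (here refl) = true ∷ [] , (λ ()) , refl
    walk-reaches (position c _ (r′ ∷ rs) (_ ∷ below)) (there e∈rs)
      with walk-reaches (position c r′ rs below) e∈rs
    ... | w , _ , walk≡ = false ∷ w , (λ ()) , walk≡

    root : Position
    root = enter ⊤

    decode : List Bool → Dot
    decode s = dot (walk root s)

    decode-monotone : ∀ b a → b ≼ω a → decode b ≼ decode a
    decode-monotone _ a (u , refl) rewrite foldl-++ move root a u = walk-≼ (walk root a) u

    decode-++-≺ : ∀ a u → length (remaining (walk root a)) < length u → decode (a ++ u) ≺ decode a
    decode-++-≺ a u rem<u rewrite foldl-++ move root a u = walk-≺ (walk root a) u rem<u

    decode-reflects-# : ∀ a b → decode a # decode b → a #ω b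
    decode-reflects-# a b da#db =
      (λ a≼b → #⇒¬common-lower-bound (≼-refl (decode a)) (decode-monotone a b a≼b) da#db) ,
      (λ b≼a → #⇒¬common-lower-bound (decode-monotone b a b≼a) (≼-refl (decode b)) da#db)

    decode-isPoint : ∀ p → CN.IsPoint p → IsPoint (decode ∘ p)
    decode-isPoint p p-point =
      progressive-isPoint spraid (λ n → decode-monotone _ _ (CN.IsPoint.decr p-point n)) progress
      where
      progress : ∀ n → ∃ λ m → decode (p m) ≺ decode (p n)
      progress n with IsPoint-deepens p-point (suc (length (remaining (walk root (p n))))) n
      ... | m , u , pm≡pn++u , rem<u =
        m , subst (λ w → decode w ≺ decode (p n)) (sym pm≡pn++u) (decode-++-≺ (p n) u rem<u)

    decodeMorphism : RefinementMorphism Cantor raw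
    decodeMorphism = record
      { fun        = decode
      ; reflect-#  = decode-reflects-#
      ; preserve-≼ = decode-monotone
      ; points     = decode-isPoint
      }

    module _ {x : ℕ → Dot} (x-point : IsPoint x) where
      open IsPoint x-point using (decr)

      record Stage (k : ℕ) : Set where
        constructor stageAt
        field
          target  : Dot
          index   : ℕ
          word    : List Bool
          x-below : x index ≼ target
          late    : k ≤ index
          reaches : walk root word ≡ enter target

      next : ∀ {k} (σ : Stage k) → Σ (Stage (suc k)) λ τ → Stage.word τ CN.≺ Stage.word σ
      next {k} (stageAt d i s xi≼d _ walk-s≡) with IsPoint.progress x-point i
      ... | m , xm≺xi with immSuc-above trea (≺-≼-trans xm≺xi xi≼d)
      ...   | e , e⋖d , xm≼e with walk-reaches (enter d) (SuccessorList.complete (successors d) e e⋖d)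
      ...     | w , w≢[] , walk-w≡ =
        stageAt e (m ⊔ suc k) (s ++ w) xm⊔k≼e (m≤n⊔m m (suc k)) walk-s++w≡ , (w , refl) , ++-≢ s w≢[]
        where
        xm⊔k≼e : x (m ⊔ suc k) ≼ e
        xm⊔k≼e = ≼-trans (decreasing-antitone decr (m≤m⊔n m (suc k))) xm≼e

        open ≡-Reasoning
        walk-s++w≡ : walk root (s ++ w) ≡ enter e
        walk-s++w≡ = begin
          walk root (s ++ w)        ≡⟨ foldl-++ move root s w ⟩
          walk (walk root s) w      ≡⟨ cong (λ p → walk p w) walk-s≡ ⟩
          walk (enter d) w          ≡⟨ walk-w≡ ⟩
          enter e                   ∎

      stage : ∀ k → Stage k
      stage zero    = stageAt ⊤ 0 [] (⊤-max (x 0)) z≤n refl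
      stage (suc k) = proj₁ (next (stage k))

      word : ℕ → List Bool
      word k = Stage.word (stage k)

      word-isPoint : CN.IsPoint word
      word-isPoint = strictly-extending-isPoint λ k → proj₂ (next (stage k))

      decode-word-≡ₚ : (decode ∘ word) ≡ₚ x
      decode-word-≡ₚ (n , dn#xn) =
        #⇒¬common-lower-bound (Stage.x-below σ) (decreasing-antitone decr (Stage.late σ))
          (subst (λ p → dot p # x n) (Stage.reaches σ) dn#xn)
        where
        σ : Stage n
        σ = stage n

    decode-surjective : Surjective Cantor raw Cantor-≟ (inj₁ decodeMorphism)
    decode-surjective x x-point = word x-point , word-isPoint x-point , decode-word-≡ₚ x-point

mainTheorem7 : (V : PreNatural) → IsFann V →
    Σ (NaturalMorphism Cantor (PreNatural.raw V) Cantor-≟) λ f →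
      Surjective Cantor (PreNatural.raw V) Cantor-≟ f
mainTheorem7 V F = inj₁ (decodeMorphism V F) , decode-surjective V F
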